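{- Let $S$ and $T$ be association schemes on finite sets $X$ and $Y$, and $\phi$ an admissible morphism from $S$ to $T$. For $s\in S$ write $n_s^\phi=n_s/n_{\phi(s)}$. Then for all $p,q\in S$ and $t\in T$, \[\sum_{s\in S:\ \phi(s)=t}a_{pq}^s\,n_s^\phi=a_{\phi(p)\phi(q)}^t\,n_p^\phi\,n_q^\phi.\]
   Context: An association scheme on a finite set $X$ is a partition $S$ of $X\times X$ into nonempty subsets such that $1_X=\{(x,x)\}\in S$; $s^*=\{(x,y):(y,x)\in s\}\in S$; and for $p,q,r\in S$ there is an integer $a_{pq}^r\ge0$ (structure constant) with $|\{y:(x,y)\in p,(y,z)\in q\}|=a_{pq}^r$ whenever $(x,z)\in r$. The valency $n_s=|\{y:(x,y)\in s\}|$ (independent of $x$). A morphism from $S$ on $X$ to $T$ on $Y$ is a function $\phi:X\cup S\to Y\cup T$ with $\phi(X)\subseteq Y$, $\phi(S)\subseteq T$, $(\phi(x_1),\phi(x_2))\in\phi(s)$ whenever $(x_1,x_2)\in s$; it is admissible if whenever $(\phi(x),y)\in\phi(s)$ there is $x'\in X$ with $\phi(x')=y$ and $(x,x')\in s$. -}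

module Defs where

open import Data.Nat using (ℕ; zero; suc; _+_; NonZero; _≤_; z≤n; s≤s; >-nonZero)
open import Data.Nat.Properties using (≤-trans; m≤n+m; ≤-reflexive)
open import Relation.Nullary using (yes; no)
open import Data.Empty using (⊥-elim)
open import Data.Fin using (Fin; zero; suc; _≟_)
open import Data.Bool using (Bool; true; false; if_then_else_; _∧_)
open import Data.Product using (Σ; ∃; ∃₂; _×_; _,_)
open import Relation.Nullary.Decidable using (⌊_⌋)
open import Relation.Binary.PropositionalEquality using (_≡_; refl; cong)
open import Function.Bundles using (_⇔_)
open import Data.Integer using (+_)
open import Data.Rational using (ℚ; _/_) renaming (_+_ to _+ℚ_)
import Data.Rational as ℚ

count : (n : ℕ) → (Fin n → Bool) → ℕ
count zero    f = 0
count (suc n) f = (if f zero then 1 else 0) + count n (λ i → f (suc i))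

sumℚ : (n : ℕ) → (Fin n → ℚ) → ℚ
sumℚ zero    f = ℚ.0ℚ
sumℚ (suc n) f = f zero +ℚ sumℚ n (λ i → f (suc i))

_=ᶠ_ : {n : ℕ} → Fin n → Fin n → Bool
i =ᶠ j = ⌊ i ≟ j ⌋

-- An association scheme on the finite set X = Fin pts whose relations are
-- indexed by Fin rank: rel x y is the (unique) relation s ∈ S containing (x,y),
-- so the relations form a partition of X × X; surj says each relation is nonempty.
record AssocScheme : Set where
  field
    pts   : ℕ
    rank  : ℕ
    rel   : Fin pts → Fin pts → Fin rank
    surj  : ∀ s → ∃₂ λ x y → rel x y ≡ s
    one      : Fin rank
    one-diag : ∀ x y → (rel x y ≡ one) ⇔ (x ≡ y)
    star      : Fin rank → Fin rank
    star-spec : ∀ x y → rel y x ≡ star (rel x y)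
    a      : Fin rank → Fin rank → Fin rank → ℕ
    a-spec : ∀ p q r x z → rel x z ≡ r →
             count pts (λ y → (rel x y =ᶠ p) ∧ (rel y z =ᶠ q)) ≡ a p q r

  valencyAt : Fin pts → Fin rank → ℕ
  valencyAt x s = count pts (λ y → rel x y =ᶠ s)

  field
    -- n_s: the valency, independent of x (as in the paper's definition;
    -- this independence also follows from a-spec)
    valency      : Fin rank → ℕ
    valency-spec : ∀ x s → valencyAt x s ≡ valency s

open AssocScheme public

private
  count-pos : (n : ℕ) (f : Fin n → Bool) (i : Fin n) → f i ≡ true → 1 ≤ count n f
  count-pos (suc n) f zero eq rewrite eq = s≤s z≤n
  count-pos (suc n) f (suc i) eq =
    ≤-trans (count-pos n (λ j → f (suc j)) i eq) (m≤n+m _ _)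

  self-eq : {n : ℕ} (i : Fin n) → (i =ᶠ i) ≡ true
  self-eq i with i ≟ i
  ... | yes _ = refl
  ... | no ¬p = ⊥-elim (¬p refl)

-- valencies are nonzero (every relation is nonempty)
valency-pos : (S : AssocScheme) (s : Fin (rank S)) → 1 ≤ valency S s
valency-pos S s with surj S s
... | x , y , refl =
  ≤-trans (count-pos _ _ y (self-eq (rel S x y))) (≤-reflexive (valency-spec S x (rel S x y)))

instance
  valency-nonZero : {S : AssocScheme} {s : Fin (rank S)} → NonZero (valency S s)
  valency-nonZero {S} {s} = >-nonZero (valency-pos S s)

record Morphism (S T : AssocScheme) : Set where
  field
    onPt  : Fin (pts S) → Fin (pts T)
    onRel : Fin (rank S) → Fin (rank T)
    preserves : ∀ x₁ x₂ → rel T (onPt x₁) (onPt x₂) ≡ onRel (rel S x₁ x₂)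

open Morphism public

Admissible : {S T : AssocScheme} → Morphism S T → Set
Admissible {S} {T} φ =
  ∀ x s y → rel T (onPt φ x) y ≡ onRel φ s →
  ∃ λ x′ → onPt φ x′ ≡ y × rel S x x′ ≡ s

nφ : {S T : AssocScheme} → Morphism S T → Fin (rank S) → ℚ
nφ {S} {T} φ s = _/_ (+ valency S s) (valency T (onRel φ s)) {{>-nonZero (valency-pos T (onRel φ s))}}

module Submission where

-- Everything is reduced to counting in ℕ with finite sums of 0/1 indicators.
--  * For x ∈ X and s ∈ S, admissibility shows that each φ-fibre over a point y′
--    with (ψ x, y′) ∈ Φ s contains exactly  c_s = Σ_k [Φ k = 1_T] a_{sk}^s
--    points x′ with (x, x′) ∈ s, and no such points when (ψ x, y′) ∉ Φ s.
--    Summed against any weight h on Y this is the "pushforward" identity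
--      Σ_{x′} [(x,x′) ∈ s] h(ψ x′) = c_s Σ_{y′} [(ψ x, y′) ∈ Φ s] h(y′),
--    and taking h = 1 gives n_s = c_s n_{Φ s}, i.e. n_s^φ = c_s.
--  * In any scheme, the number of triangles (x, y, z) with (x,y) ∈ p,
--    (y,z) ∈ q, weighted by w((x,z)), equals Σ_s n_s a_{pq}^s w(s).
--  * Counting the triangles of S over x with Φ((x,z)) = t directly gives
--    n_t Σ_{Φ s = t} a_{pq}^s c_s; pushing them forward twice to T gives
--    c_p c_q n_t a_{ΦpΦq}^t.  Cancelling n_t ≠ 0 and embedding ℕ into ℚ
--    yields the lemma.

open import Defs

module Counting where

  open import Data.Nat using (ℕ; zero; suc; _+_; _*_)
  open import Data.Nat.Properties using (+-*-semiring; *-identityˡ; +-identityʳ; *-assoc)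
  open import Data.Fin using (Fin; zero; suc; _≟_)
  open import Data.Bool using (Bool; true; false; if_then_else_; _∧_)
  open import Relation.Nullary using (yes; no; contradiction)
  open import Relation.Nullary.Decidable using (⌊⌋-map′)
  open import Relation.Binary.PropositionalEquality
  open ≡-Reasoning

  open import Algebra.Properties.Semiring.Sum +-*-semiring public
    using (sum-syntax; sum-cong-≗; ∑-comm; *-distribˡ-sum; *-distribʳ-sum; sum-replicate-zero)

  χ : Bool → ℕ
  χ b = if b then 1 else 0

  count-as-∑ : ∀ n (f : Fin n → Bool) → count n f ≡ ∑[ i < n ] χ (f i)
  count-as-∑ zero    f = refl
  count-as-∑ (suc n) f = cong (χ (f zero) +_) (count-as-∑ n (λ i → f (suc i)))

  χ-∧ : ∀ b c → χ (b ∧ c) ≡ χ b * χ c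
  χ-∧ true  c = sym (+-identityʳ (χ c))
  χ-∧ false c = refl

  =ᶠ-cong : ∀ {n m} {i j : Fin n} {k l : Fin m} →
            (i ≡ j → k ≡ l) → (k ≡ l → i ≡ j) → (i =ᶠ j) ≡ (k =ᶠ l)
  =ᶠ-cong {i = i} {j} {k} {l} to from with i ≟ j | k ≟ l
  ... | yes _   | yes _   = refl
  ... | no _    | no _    = refl
  ... | yes i≡j | no k≢l  = contradiction (to i≡j) k≢l
  ... | no i≢j  | yes k≡l = contradiction (from k≡l) i≢j

  =ᶠ-sym : ∀ {n} (i j : Fin n) → (i =ᶠ j) ≡ (j =ᶠ i)
  =ᶠ-sym i j = =ᶠ-cong sym sym

  χ-subst : ∀ {n} (i j : Fin n) (h : Fin n → ℕ) → χ (i =ᶠ j) * h i ≡ χ (i =ᶠ j) * h j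
  χ-subst i j h with i ≟ j
  ... | yes refl = refl
  ... | no _     = refl

  ∑-δ : ∀ {n} (i : Fin n) (h : Fin n → ℕ) → ∑[ j < n ] (χ (i =ᶠ j) * h j) ≡ h i
  ∑-δ {suc n} zero h = begin
    1 * h zero + ∑[ j < n ] 0  ≡⟨ cong₂ _+_ (*-identityˡ (h zero)) (sum-replicate-zero n) ⟩
    h zero + 0                 ≡⟨ +-identityʳ (h zero) ⟩
    h zero                     ∎
  ∑-δ {suc n} (suc i) h = begin
    ∑[ j < n ] (χ (suc i =ᶠ suc j) * h (suc j))
      ≡⟨ sum-cong-≗ (λ j → cong (λ b → χ b * h (suc j)) (⌊⌋-map′ _ _ (i ≟ j))) ⟩
    ∑[ j < n ] (χ (i =ᶠ j) * h (suc j))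
      ≡⟨ ∑-δ i (λ j → h (suc j)) ⟩
    h (suc i) ∎

  ∑-fibres : ∀ {n m} (g : Fin n → Fin m) (f : Fin n → ℕ) (h : Fin m → ℕ) →
             ∑[ i < n ] (f i * h (g i)) ≡ ∑[ j < m ] (∑[ i < n ] (f i * χ (g i =ᶠ j)) * h j)
  ∑-fibres {n} {m} g f h = begin
    ∑[ i < n ] (f i * h (g i))
      ≡⟨ sum-cong-≗ (λ i → cong (f i *_) (sym (∑-δ (g i) h))) ⟩
    ∑[ i < n ] (f i * ∑[ j < m ] (χ (g i =ᶠ j) * h j))
      ≡⟨ sum-cong-≗ (λ i → *-distribˡ-sum (f i) (λ j → χ (g i =ᶠ j) * h j)) ⟩
    ∑[ i < n ] ∑[ j < m ] (f i * (χ (g i =ᶠ j) * h j))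
      ≡⟨ ∑-comm (λ i j → f i * (χ (g i =ᶠ j) * h j)) ⟩
    ∑[ j < m ] ∑[ i < n ] (f i * (χ (g i =ᶠ j) * h j))
      ≡⟨ sum-cong-≗ (λ j → trans (sum-cong-≗ (λ i → sym (*-assoc (f i) _ (h j))))
                                 (sym (*-distribʳ-sum (h j) (λ i → f i * χ (g i =ᶠ j))))) ⟩
    ∑[ j < m ] (∑[ i < n ] (f i * χ (g i =ᶠ j)) * h j) ∎

module SchemeCounting (S : AssocScheme) where

  open import Data.Nat using (ℕ; _*_)
  open import Data.Nat.Properties using (*-identityˡ; *-assoc; *-commutativeSemigroup)
  open import Algebra.Properties.CommutativeSemigroup *-commutativeSemigroup using (x∙yz≈z∙xy)
  open import Data.Fin using (Fin)
  open import Data.Bool using (_∧_)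
  open import Relation.Binary.PropositionalEquality
  open ≡-Reasoning
  open Counting

  valency-as-∑ : ∀ x s → ∑[ y < pts S ] χ (rel S x y =ᶠ s) ≡ valency S s
  valency-as-∑ x s = trans (sym (count-as-∑ (pts S) _)) (valency-spec S x s)

  a-as-∑ : ∀ x z p q →
           ∑[ y < pts S ] (χ (rel S x y =ᶠ p) * χ (rel S y z =ᶠ q)) ≡ a S p q (rel S x z)
  a-as-∑ x z p q = begin
    ∑[ y < pts S ] (χ (rel S x y =ᶠ p) * χ (rel S y z =ᶠ q))
      ≡⟨ sum-cong-≗ (λ y → sym (χ-∧ (rel S x y =ᶠ p) _)) ⟩
    ∑[ y < pts S ] χ ((rel S x y =ᶠ p) ∧ (rel S y z =ᶠ q))
      ≡⟨ sym (count-as-∑ (pts S) _) ⟩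
    count (pts S) (λ y → (rel S x y =ᶠ p) ∧ (rel S y z =ᶠ q))
      ≡⟨ a-spec S p q (rel S x z) x z refl ⟩
    a S p q (rel S x z) ∎

  -- Triangles x → y → z with (x,y) ∈ p and (y,z) ∈ q, weighted by a function
  -- w of the relation (x,z): grouping them by z and then by (x,z) gives n_s a_{pq}^s.
  triangles : ∀ x p q (w : Fin (rank S) → ℕ) →
    ∑[ y < pts S ] (χ (rel S x y =ᶠ p) * ∑[ z < pts S ] (χ (rel S y z =ᶠ q) * w (rel S x z)))
      ≡ ∑[ s < rank S ] (valency S s * (a S p q s * w s))
  triangles x p q w = begin
    ∑[ y < X ] (χ (r x y =ᶠ p) * ∑[ z < X ] (χ (r y z =ᶠ q) * w (r x z)))
      ≡⟨ sum-cong-≗ (λ y → *-distribˡ-sum (χ (r x y =ᶠ p)) (λ z → χ (r y z =ᶠ q) * w (r x z))) ⟩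
    ∑[ y < X ] ∑[ z < X ] (χ (r x y =ᶠ p) * (χ (r y z =ᶠ q) * w (r x z)))
      ≡⟨ ∑-comm (λ y z → χ (r x y =ᶠ p) * (χ (r y z =ᶠ q) * w (r x z))) ⟩
    ∑[ z < X ] ∑[ y < X ] (χ (r x y =ᶠ p) * (χ (r y z =ᶠ q) * w (r x z)))
      ≡⟨ sum-cong-≗ (λ z → trans (sum-cong-≗ {X} (λ y → sym (*-assoc (χ (r x y =ᶠ p)) _ _)))
           (sym (*-distribʳ-sum (w (r x z)) (λ y → χ (r x y =ᶠ p) * χ (r y z =ᶠ q))))) ⟩
    ∑[ z < X ] (∑[ y < X ] (χ (r x y =ᶠ p) * χ (r y z =ᶠ q)) * w (r x z))
      ≡⟨ sum-cong-≗ (λ z → cong (_* w (r x z)) (a-as-∑ x z p q)) ⟩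
    ∑[ z < X ] (a S p q (r x z) * w (r x z))
      ≡⟨ sum-cong-≗ (λ z → sym (*-identityˡ (a S p q (r x z) * w (r x z)))) ⟩
    ∑[ z < X ] (1 * (a S p q (r x z) * w (r x z)))
      ≡⟨ ∑-fibres (r x) (λ _ → 1) (λ s → a S p q s * w s) ⟩
    ∑[ s < rank S ] (∑[ z < X ] (1 * χ (r x z =ᶠ s)) * (a S p q s * w s))
      ≡⟨ sum-cong-≗ (λ s → cong (_* (a S p q s * w s))
           (trans (sum-cong-≗ {X} (λ z → *-identityˡ _)) (valency-as-∑ x s))) ⟩
    ∑[ s < rank S ] (valency S s * (a S p q s * w s)) ∎
    where
    X = pts S
    r = rel S

  triangles-closing-in : ∀ x p q t →
    ∑[ y < pts S ] (χ (rel S x y =ᶠ p) * ∑[ z < pts S ] (χ (rel S y z =ᶠ q) * χ (rel S x z =ᶠ t)))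
      ≡ valency S t * a S p q t
  triangles-closing-in x p q t = begin
    ∑[ y < pts S ] (χ (rel S x y =ᶠ p) * ∑[ z < pts S ] (χ (rel S y z =ᶠ q) * χ (rel S x z =ᶠ t)))
      ≡⟨ triangles x p q (λ s → χ (s =ᶠ t)) ⟩
    ∑[ s < rank S ] (valency S s * (a S p q s * χ (s =ᶠ t)))
      ≡⟨ sum-cong-≗ (λ s → trans (x∙yz≈z∙xy (valency S s) (a S p q s) (χ (s =ᶠ t)))
                                 (cong (λ b → χ b * (valency S s * a S p q s)) (=ᶠ-sym s t))) ⟩
    ∑[ s < rank S ] (χ (t =ᶠ s) * (valency S s * a S p q s))
      ≡⟨ ∑-δ t (λ s → valency S s * a S p q s) ⟩
    valency S t * a S p q t ∎

module Fibres (S T : AssocScheme) (φ : Morphism S T) (adm : Admissible φ) where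

  open import Data.Nat using (ℕ; _*_)
  open import Data.Nat.Properties using (*-identityʳ; +-identityʳ; *-cancelˡ-≡; *-commutativeSemigroup)
  open import Data.Nat.Tactic.RingSolver using (solve-∀)
  open import Algebra.Properties.CommutativeSemigroup *-commutativeSemigroup using (xy∙z≈y∙xz; x∙yz≈y∙xz)
  open import Data.Fin using (Fin; _≟_)
  open import Data.Product using (_,_)
  open import Relation.Nullary using (yes; no; contradiction)
  open import Relation.Binary.PropositionalEquality
  open import Function.Bundles using (Equivalence)
  open ≡-Reasoning
  open Counting
  open SchemeCounting using (valency-as-∑; a-as-∑; triangles; triangles-closing-in)

  ψ : Fin (pts S) → Fin (pts T)
  ψ = onPt φ

  Φ : Fin (rank S) → Fin (rank T)
  Φ = onRel φ

  -- c_s: the number of points x′ with (x, x′) ∈ s in the φ-fibre of a point x₀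
  -- with (x, x₀) ∈ s; it turns out to be n_s^φ.
  fibreValency : Fin (rank S) → ℕ
  fibreValency s = ∑[ k < rank S ] (a S s k s * χ (Φ k =ᶠ one T))

  same-image : ∀ x′ x₀ → (ψ x′ =ᶠ ψ x₀) ≡ (Φ (rel S x′ x₀) =ᶠ one T)
  same-image x′ x₀ = =ᶠ-cong
    (λ e → trans (sym (preserves φ x′ x₀)) (Equivalence.from (one-diag T _ _) e))
    (λ e → Equivalence.to (one-diag T _ _) (trans (preserves φ x′ x₀) e))

  fibre-through : ∀ x x₀ →
    ∑[ x′ < pts S ] (χ (rel S x x′ =ᶠ rel S x x₀) * χ (ψ x′ =ᶠ ψ x₀)) ≡ fibreValency (rel S x x₀)
  fibre-through x x₀ = begin
    ∑[ x′ < pts S ] (χ (rel S x x′ =ᶠ s) * χ (ψ x′ =ᶠ ψ x₀))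
      ≡⟨ sum-cong-≗ (λ x′ → cong (λ b → χ (rel S x x′ =ᶠ s) * χ b) (same-image x′ x₀)) ⟩
    ∑[ x′ < pts S ] (χ (rel S x x′ =ᶠ s) * χ (Φ (rel S x′ x₀) =ᶠ one T))
      ≡⟨ ∑-fibres (λ x′ → rel S x′ x₀) (λ x′ → χ (rel S x x′ =ᶠ s)) (λ k → χ (Φ k =ᶠ one T)) ⟩
    ∑[ k < rank S ] (∑[ x′ < pts S ] (χ (rel S x x′ =ᶠ s) * χ (rel S x′ x₀ =ᶠ k)) * χ (Φ k =ᶠ one T))
      ≡⟨ sum-cong-≗ (λ k → cong (_* χ (Φ k =ᶠ one T)) (a-as-∑ S x x₀ s k)) ⟩
    fibreValency s ∎
    where s = rel S x x₀

  -- The fibre of y′ contains c_s points x′ with (x,x′) ∈ s if (ψ x, y′) ∈ Φ s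
  -- (admissibility supplies one such point x₀), and none otherwise.
  fibre-count : ∀ x s y′ →
    ∑[ x′ < pts S ] (χ (rel S x x′ =ᶠ s) * χ (ψ x′ =ᶠ y′)) ≡ χ (rel T (ψ x) y′ =ᶠ Φ s) * fibreValency s
  fibre-count x s y′ with rel T (ψ x) y′ ≟ Φ s
  ... | yes related with adm x s y′ related
  ...   | x₀ , refl , refl = trans (fibre-through x x₀) (sym (+-identityʳ _))
  fibre-count x s y′ | no unrelated = trans (sum-cong-≗ outside) (sum-replicate-zero (pts S))
    where
    outside : ∀ x′ → χ (rel S x x′ =ᶠ s) * χ (ψ x′ =ᶠ y′) ≡ 0
    outside x′ with rel S x x′ ≟ s | ψ x′ ≟ y′
    ... | yes refl | yes refl = contradiction (preserves φ x x′) unrelated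
    ... | yes _    | no _     = refl
    ... | no _     | _        = refl

  pushforward : ∀ x s (h : Fin (pts T) → ℕ) →
    ∑[ x′ < pts S ] (χ (rel S x x′ =ᶠ s) * h (ψ x′))
      ≡ fibreValency s * ∑[ y′ < pts T ] (χ (rel T (ψ x) y′ =ᶠ Φ s) * h y′)
  pushforward x s h = begin
    ∑[ x′ < pts S ] (χ (rel S x x′ =ᶠ s) * h (ψ x′))
      ≡⟨ ∑-fibres ψ (λ x′ → χ (rel S x x′ =ᶠ s)) h ⟩
    ∑[ y′ < pts T ] (∑[ x′ < pts S ] (χ (rel S x x′ =ᶠ s) * χ (ψ x′ =ᶠ y′)) * h y′)
      ≡⟨ sum-cong-≗ (λ y′ → cong (_* h y′) (fibre-count x s y′)) ⟩
    ∑[ y′ < pts T ] ((χ (rel T (ψ x) y′ =ᶠ Φ s) * fibreValency s) * h y′)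
      ≡⟨ sum-cong-≗ (λ y′ → xy∙z≈y∙xz (χ (rel T (ψ x) y′ =ᶠ Φ s)) (fibreValency s) (h y′)) ⟩
    ∑[ y′ < pts T ] (fibreValency s * (χ (rel T (ψ x) y′ =ᶠ Φ s) * h y′))
      ≡⟨ sym (*-distribˡ-sum (fibreValency s) (λ y′ → χ (rel T (ψ x) y′ =ᶠ Φ s) * h y′)) ⟩
    fibreValency s * ∑[ y′ < pts T ] (χ (rel T (ψ x) y′ =ᶠ Φ s) * h y′) ∎

  -- n_s = c_s n_{Φ s}: the case h = 1 of the pushforward.
  valency-factorises : ∀ s → valency S s ≡ fibreValency s * valency T (Φ s)
  valency-factorises s with surj S s
  ... | x , _ , _ = begin
    valency S s
      ≡⟨ sym (valency-as-∑ S x s) ⟩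
    ∑[ x′ < pts S ] χ (rel S x x′ =ᶠ s)
      ≡⟨ sum-cong-≗ (λ x′ → sym (*-identityʳ (χ (rel S x x′ =ᶠ s)))) ⟩
    ∑[ x′ < pts S ] (χ (rel S x x′ =ᶠ s) * 1)
      ≡⟨ pushforward x s (λ _ → 1) ⟩
    fibreValency s * ∑[ y′ < pts T ] (χ (rel T (ψ x) y′ =ᶠ Φ s) * 1)
      ≡⟨ cong (fibreValency s *_) (trans (sum-cong-≗ {pts T} (λ y′ → *-identityʳ _))
                                         (valency-as-∑ T (ψ x) (Φ s))) ⟩
    fibreValency s * valency T (Φ s) ∎

  fibreSum : Fin (rank S) → Fin (rank S) → Fin (rank T) → ℕ
  fibreSum p q t = ∑[ s < rank S ] (χ (Φ s =ᶠ t) * (a S p q s * fibreValency s))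

  module DoubleCounting (p q : Fin (rank S)) (t : Fin (rank T)) (x : Fin (pts S)) where

    triangleCount : ℕ
    triangleCount =
      ∑[ y < pts S ] (χ (rel S x y =ᶠ p) * ∑[ z < pts S ] (χ (rel S y z =ᶠ q) * χ (Φ (rel S x z) =ᶠ t)))

    -- grouped by the relation s = (x,z): each s contributes n_s a_{pq}^s = n_t c_s a_{pq}^s
    count-in-S : triangleCount ≡ valency T t * fibreSum p q t
    count-in-S = begin
      triangleCount
        ≡⟨ triangles S x p q (λ s → χ (Φ s =ᶠ t)) ⟩
      ∑[ s < rank S ] (valency S s * (a S p q s * χ (Φ s =ᶠ t)))
        ≡⟨ sum-cong-≗ term ⟩
      ∑[ s < rank S ] (valency T t * (χ (Φ s =ᶠ t) * (a S p q s * fibreValency s)))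
        ≡⟨ sym (*-distribˡ-sum (valency T t) (λ s → χ (Φ s =ᶠ t) * (a S p q s * fibreValency s))) ⟩
      valency T t * fibreSum p q t ∎
      where
      rearrange : ∀ c v a e → (c * v) * (a * e) ≡ e * (v * (a * c))
      rearrange = solve-∀

      term : ∀ s → valency S s * (a S p q s * χ (Φ s =ᶠ t))
                 ≡ valency T t * (χ (Φ s =ᶠ t) * (a S p q s * fibreValency s))
      term s = begin
        valency S s * (a S p q s * χ (Φ s =ᶠ t))
          ≡⟨ cong (_* (a S p q s * χ (Φ s =ᶠ t))) (valency-factorises s) ⟩
        (fibreValency s * valency T (Φ s)) * (a S p q s * χ (Φ s =ᶠ t))
          ≡⟨ rearrange (fibreValency s) (valency T (Φ s)) (a S p q s) (χ (Φ s =ᶠ t)) ⟩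
        χ (Φ s =ᶠ t) * (valency T (Φ s) * (a S p q s * fibreValency s))
          ≡⟨ χ-subst (Φ s) t (λ r → valency T r * (a S p q s * fibreValency s)) ⟩
        χ (Φ s =ᶠ t) * (valency T t * (a S p q s * fibreValency s))
          ≡⟨ x∙yz≈y∙xz (χ (Φ s =ᶠ t)) (valency T t) _ ⟩
        valency T t * (χ (Φ s =ᶠ t) * (a S p q s * fibreValency s)) ∎

    -- pushed forward to T, first along z and then along y
    count-in-T : triangleCount ≡ fibreValency q * (fibreValency p * (valency T t * a T (Φ p) (Φ q) t))
    count-in-T = begin
      triangleCount
        ≡⟨ sum-cong-≗ (λ y → cong (χ (rel S x y =ᶠ p) *_) (inner y)) ⟩
      ∑[ y < pts S ] (χ (rel S x y =ᶠ p) * (fibreValency q * G (ψ y)))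
        ≡⟨ sum-cong-≗ (λ y → x∙yz≈y∙xz (χ (rel S x y =ᶠ p)) (fibreValency q) (G (ψ y))) ⟩
      ∑[ y < pts S ] (fibreValency q * (χ (rel S x y =ᶠ p) * G (ψ y)))
        ≡⟨ sym (*-distribˡ-sum (fibreValency q) (λ y → χ (rel S x y =ᶠ p) * G (ψ y))) ⟩
      fibreValency q * ∑[ y < pts S ] (χ (rel S x y =ᶠ p) * G (ψ y))
        ≡⟨ cong (fibreValency q *_) (pushforward x p G) ⟩
      fibreValency q * (fibreValency p * ∑[ y′ < pts T ] (χ (rel T u y′ =ᶠ Φ p) * G y′))
        ≡⟨ cong (λ m → fibreValency q * (fibreValency p * m)) (triangles-closing-in T u (Φ p) (Φ q) t) ⟩
      fibreValency q * (fibreValency p * (valency T t * a T (Φ p) (Φ q) t)) ∎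
      where
      u : Fin (pts T)
      u = ψ x

      G : Fin (pts T) → ℕ
      G y′ = ∑[ z′ < pts T ] (χ (rel T y′ z′ =ᶠ Φ q) * χ (rel T u z′ =ᶠ t))

      inner : ∀ y → ∑[ z < pts S ] (χ (rel S y z =ᶠ q) * χ (Φ (rel S x z) =ᶠ t)) ≡ fibreValency q * G (ψ y)
      inner y = trans
        (sum-cong-≗ {pts S} (λ z → cong (λ r → χ (rel S y z =ᶠ q) * χ (r =ᶠ t)) (sym (preserves φ x z))))
        (pushforward y q (λ z′ → χ (rel T u z′ =ᶠ t)))

  fibreSum-formula : ∀ p q t → fibreSum p q t ≡ a T (Φ p) (Φ q) t * fibreValency p * fibreValency q
  fibreSum-formula p q t with surj S p
  ... | x , _ , _ = *-cancelˡ-≡ _ _ (valency T t) {{valency-nonZero {T} {t}}} (begin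
    valency T t * fibreSum p q t
      ≡⟨ sym count-in-S ⟩
    triangleCount
      ≡⟨ count-in-T ⟩
    fibreValency q * (fibreValency p * (valency T t * a T (Φ p) (Φ q) t))
      ≡⟨ rearrange (fibreValency q) (fibreValency p) (valency T t) (a T (Φ p) (Φ q) t) ⟩
    valency T t * (a T (Φ p) (Φ q) t * fibreValency p * fibreValency q) ∎)
    where
    open DoubleCounting p q t x
    rearrange : ∀ c c′ v b → c * (c′ * (v * b)) ≡ v * (b * c′ * c)
    rearrange = solve-∀

open import Data.Fin using (Fin)
open import Data.Bool using (if_then_else_)
open import Data.Integer using (+_)
open import Data.Rational using (ℚ; 0ℚ; _*_; _/_)
open import Relation.Binary.PropositionalEquality using (_≡_)

module NatEmbedding where

  open import Data.Nat as ℕ using (ℕ; zero; suc; NonZero)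
  open import Data.Nat.Properties using (+-identityʳ)
  open import Data.Nat.Divisibility using (∣1⇒≡1)
  open import Data.Nat.Coprimality using (Coprime)
  import Data.Integer as ℤ
  import Data.Integer.Properties as ℤ
  open import Data.Rational using (mkℚ) renaming (_+_ to _+ℚ_)
  open import Data.Rational.Properties using (normalize-coprime; fromℚᵘ-cong)
  open import Data.Rational.Unnormalised using (mkℚᵘ; *≡*)
  open import Data.Product using (_,_)
  open import Data.Bool using (true; false)
  import Data.Fin as Fin
  open import Relation.Binary.PropositionalEquality
  open ≡-Reasoning
  open Counting using (χ; sum-syntax)

  ι : ℕ → ℚ
  ι m = + m / 1

  coprime-1 : ∀ m → Coprime m 1
  coprime-1 m (_ , d∣1) = ∣1⇒≡1 d∣1

  -- ι m in normal form, so that ℚ-arithmetic on it computes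
  ι-normal : ∀ m → ι m ≡ mkℚ (+ m) 0 (coprime-1 m)
  ι-normal m = normalize-coprime (coprime-1 m)

  ι-+ : ∀ m n → ι m +ℚ ι n ≡ ι (m ℕ.+ n)
  ι-+ m n rewrite ι-normal m | ι-normal n = cong (_/ 1) (begin
    + m ℤ.* + 1 ℤ.+ + n ℤ.* + 1 ≡⟨ cong₂ ℤ._+_ (ℤ.*-identityʳ (+ m)) (ℤ.*-identityʳ (+ n)) ⟩
    + m ℤ.+ + n                 ≡⟨ sym (ℤ.pos-+ m n) ⟩
    + (m ℕ.+ n)                 ∎)

  ι-* : ∀ m n → ι m * ι n ≡ ι (m ℕ.* n)
  ι-* m n rewrite ι-normal m | ι-normal n = cong (_/ 1) (sym (ℤ.pos-* m n))

  ι-cancel : ∀ c v .{{_ : NonZero v}} → + (c ℕ.* v) / v ≡ ι c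
  ι-cancel c (suc v) = fromℚᵘ-cong {mkℚᵘ (+ (c ℕ.* suc v)) v} {mkℚᵘ (+ c) 0}
    (*≡* (trans (ℤ.*-identityʳ _) (ℤ.pos-* c (suc v))))

  ι-if : ∀ b m → (if b then ι m else 0ℚ) ≡ ι (χ b ℕ.* m)
  ι-if true  m = cong ι (sym (+-identityʳ m))
  ι-if false m = refl

  sumℚ-cong : ∀ n {f g : Fin n → ℚ} → (∀ i → f i ≡ g i) → sumℚ n f ≡ sumℚ n g
  sumℚ-cong zero    f≡g = refl
  sumℚ-cong (suc n) f≡g = cong₂ _+ℚ_ (f≡g Fin.zero) (sumℚ-cong n (λ i → f≡g (Fin.suc i)))

  sumℚ-ι : ∀ n (f : Fin n → ℕ) → sumℚ n (λ i → ι (f i)) ≡ ι (∑[ i < n ] f i)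
  sumℚ-ι zero    f = refl
  sumℚ-ι (suc n) f =
    trans (cong (ι (f Fin.zero) +ℚ_) (sumℚ-ι n (λ i → f (Fin.suc i)))) (ι-+ (f Fin.zero) _)

import Data.Nat as ℕ
open import Data.Rational.Properties using (/-cong)
open import Relation.Binary.PropositionalEquality using (refl; sym; trans; cong; cong₂; module ≡-Reasoning)

nφ≡fibreValency : (S T : AssocScheme) (φ : Morphism S T) (adm : Admissible φ) (s : Fin (rank S)) →
                  nφ φ s ≡ NatEmbedding.ι (Fibres.fibreValency S T φ adm s)
nφ≡fibreValency S T φ adm s =
  trans (/-cong {{valency-nonZero {T}}} {{valency-nonZero {T}}} (cong +_ (valency-factorises s)) refl)
        (ι-cancel (fibreValency s) (valency T (onRel φ s)) {{valency-nonZero {T}}})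
  where
  open Fibres S T φ adm
  open NatEmbedding

lemma6p3 : (S T : AssocScheme) (φ : Morphism S T) → Admissible φ →
    (p q : Fin (rank S)) (t : Fin (rank T)) →
    sumℚ (rank S) (λ s → if onRel φ s =ᶠ t then (+ a S p q s / 1) * nφ φ s else 0ℚ)
      ≡ ((+ a T (onRel φ p) (onRel φ q) t / 1) * nφ φ p) * nφ φ q
lemma6p3 S T φ adm p q t = begin
  sumℚ (rank S) (λ s → if Φ s =ᶠ t then ι (a S p q s) * nφ φ s else 0ℚ)
    ≡⟨ sumℚ-cong (rank S) (λ s → cong (λ r → if Φ s =ᶠ t then r else 0ℚ) (term s)) ⟩
  sumℚ (rank S) (λ s → if Φ s =ᶠ t then ι (a S p q s ℕ.* c s) else 0ℚ)
    ≡⟨ sumℚ-cong (rank S) (λ s → ι-if (Φ s =ᶠ t) (a S p q s ℕ.* c s)) ⟩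
  sumℚ (rank S) (λ s → ι (χ (Φ s =ᶠ t) ℕ.* (a S p q s ℕ.* c s)))
    ≡⟨ sumℚ-ι (rank S) (λ s → χ (Φ s =ᶠ t) ℕ.* (a S p q s ℕ.* c s)) ⟩
  ι (fibreSum p q t)
    ≡⟨ cong ι (fibreSum-formula p q t) ⟩
  ι (aT ℕ.* c p ℕ.* c q)
    ≡⟨ sym (trans (cong (_* ι (c q)) (ι-* aT (c p))) (ι-* (aT ℕ.* c p) (c q))) ⟩
  (ι aT * ι (c p)) * ι (c q)
    ≡⟨ cong₂ (λ m n → (ι aT * m) * n) (sym (nφ≡fibreValency S T φ adm p)) (sym (nφ≡fibreValency S T φ adm q)) ⟩
  (ι aT * nφ φ p) * nφ φ q ∎
  where
  open Fibres S T φ adm renaming (fibreValency to c)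
  open NatEmbedding
  open Counting using (χ)
  open ≡-Reasoning

  aT : ℕ.ℕ
  aT = a T (Φ p) (Φ q) t

  term : ∀ s → ι (a S p q s) * nφ φ s ≡ ι (a S p q s ℕ.* c s)
  term s = trans (cong (ι (a S p q s) *_) (nφ≡fibreValency S T φ adm s)) (ι-* (a S p q s) (c s))
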